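{- Let $G$ be a connected weak framework for a matroid $M$ and let $H$ be a non-empty subgraph of $G$. Then $|V(H)|-r(M|E(H))\ge |V(G)|-r(M)$.
   Context: For a graph $G$ and a vertex $v$, $\mathrm{loops}_G(v)$ denotes the set of loop-edges of $G$ at $v$. Graphs are finite and may have loops and parallel edges. A graph $G$ is a weak framework for a matroid $M$ if (1) $E(G)=E(M)$; (2) $r_M(E(H))\le |V(H)|$ for each component $H$ of $G$; and (3) for each vertex $v$ of $G$, $\mathrm{cl}_M(E(G-v))\subseteq E(G-v)\cup \mathrm{loops}_G(v)$. $M|X$ denotes the restriction of $M$ to $X$. -}

module Defs where

open import Data.Nat using (ℕ; _≤_; _+_)
open import Data.Fin using (Fin)
open import Data.Fin.Subset using (Subset; _∪_; _∩_; _⊆_; ⁅_⁆; ⊤; ∣_∣; _∈_; _∉_; Nonempty)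
open import Data.Product using (_×_; _,_; proj₁; proj₂; Σ)
open import Data.Sum using (_⊎_)
open import Relation.Binary.PropositionalEquality using (_≡_; _≢_)

record Matroid (m : ℕ) : Set where
  field
    r         : Subset m → ℕ
    r-bounded : ∀ X → r X ≤ ∣ X ∣
    r-mono    : ∀ {X Y} → X ⊆ Y → r X ≤ r Y
    r-submod  : ∀ X Y → r (X ∪ Y) + r (X ∩ Y) ≤ r X + r Y
open Matroid public

_∈cl[_]_ : ∀ {m} → Fin m → Matroid m → Subset m → Set
e ∈cl[ M ] X = r M (X ∪ ⁅ e ⁆) ≡ r M X

-- A finite graph with vertex set Fin n and edge set Fin m; each edge has
-- two (not necessarily distinct) ends. Loops and parallel edges allowed.
record Graph (n m : ℕ) : Set where
  field
    ends : Fin m → Fin n × Fin n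
open Graph public

end₁ end₂ : ∀ {n m} → Graph n m → Fin m → Fin n
end₁ G e = proj₁ (ends G e)
end₂ G e = proj₂ (ends G e)

Incident : ∀ {n m} → Graph n m → Fin m → Fin n → Set
Incident G e v = (end₁ G e ≡ v) ⊎ (end₂ G e ≡ v)

data Reach {n m} (G : Graph n m) : Fin n → Fin n → Set where
  here : ∀ {u} → Reach G u u
  step : ∀ {u w} (e : Fin m) →
         ((end₁ G e ≡ u) × (end₂ G e ≡ w)) ⊎ ((end₂ G e ≡ u) × (end₁ G e ≡ w)) →
         ∀ {v} → Reach G w v → Reach G u v

Connected : ∀ {n m} → Graph n m → Set
Connected G = ∀ u v → Reach G u v

InducedEdges : ∀ {n m} → Graph n m → Subset n → Subset m → Set
InducedEdges G S F = ∀ e → (e ∈ F → (end₁ G e ∈ S × end₂ G e ∈ S))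
                  × ((end₁ G e ∈ S × end₂ G e ∈ S) → e ∈ F)

IsComponent : ∀ {n m} → Graph n m → Subset n → Set
IsComponent G S =
  Nonempty S
  × (∀ e → (end₁ G e ∈ S → end₂ G e ∈ S) × (end₂ G e ∈ S → end₁ G e ∈ S))
  × (∀ u v → u ∈ S → v ∈ S → Reach G u v)

EdgesMinus : ∀ {n m} → Graph n m → Fin n → Subset m → Set
EdgesMinus G v F = ∀ e → (e ∈ F → ¬Inc e) × (¬Inc e → e ∈ F)
  where ¬Inc : _ → Set
        ¬Inc e = (end₁ G e ≢ v) × (end₂ G e ≢ v)

IsLoopAt : ∀ {n m} → Graph n m → Fin m → Fin n → Set
IsLoopAt G e v = (end₁ G e ≡ v) × (end₂ G e ≡ v)

-- G is a weak framework for M  (E(G) = E(M) = Fin m by construction)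
record WeakFramework {n m} (G : Graph n m) (M : Matroid m) : Set where
  field
    comp-rank : ∀ S F → IsComponent G S → InducedEdges G S F → r M F ≤ ∣ S ∣
    closure   : ∀ v F → EdgesMinus G v F →
                ∀ e → e ∈cl[ M ] F → (e ∈ F) ⊎ IsLoopAt G e v

IsSubgraph : ∀ {n m} → Graph n m → Subset n → Subset m → Set
IsSubgraph G VH EH = ∀ e → e ∈ EH → (end₁ G e ∈ VH × end₂ G e ∈ VH)

-- Grow H one vertex at a time.  While V(H) ≠ V(G), connectivity yields an
-- edge e from a vertex of H to a vertex v outside H.  All of E(H) avoids v,
-- so E(H) ⊆ E(G - v); and e is neither in E(G - v) nor a loop at v, so the
-- weak-framework axiom puts e outside cl(E(G - v)) ⊇ cl(E(H)).  Adding v and e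
-- therefore raises |V(H)| by one and r(E(H)) by at least one, so
-- |V(H)| - r(E(H)) does not increase.  Once V(H) = V(G) the inequality is
-- monotonicity of the rank.
module Submission where

open import Defs
open import Data.Nat using (suc; _+_; _∸_; _≤_; _<_; z≤n; s≤s; s≤s⁻¹)
open import Data.Fin.Subset using (Subset; ⊤; ∣_∣; Nonempty)
open import Data.Integer using (+_; _-_; _≥_)

import Data.Nat.Properties as ℕ
import Data.Integer as ℤ
import Data.Integer.Properties as ℤ
open import Data.Fin using (Fin; _≟_)
open import Data.Fin.Subset using (⊥; _∪_; _∩_; _⊆_; _⊂_; _⊃_; ⁅_⁆; _∈_; _∉_; ∁; Empty; inside; outside)
open import Data.Fin.Subset.Properties
open import Data.Fin.Subset.Induction using (⊃-wellFounded)
open import Data.Product using (∃₂; _×_; _,_; proj₁; proj₂)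
open import Data.Sum using (_⊎_; inj₁; inj₂; [_,_]′)
open import Data.Vec using (_∷_; []; tabulate)
open import Data.Vec.Properties using (lookup∘tabulate; lookup⇒[]=; []=⇒lookup)
open import Induction.WellFounded using (Acc; acc)
open import Relation.Nullary using (¬_; Dec; yes; no; does; contradiction)
open import Relation.Nullary.Decidable using (dec-true; ¬?; _×-dec_)
open import Relation.Binary.PropositionalEquality

m+q≤o+n⇒m-n≤o-q : ∀ m n o q → m + q ≤ o + n → (+ m) - (+ n) ℤ.≤ (+ o) - (+ q)
m+q≤o+n⇒m-n≤o-q m n o q m+q≤o+n = begin
  (+ m) - (+ n)        ≡⟨ ℤ.m-n≡m⊖n m n ⟩
  m ℤ.⊖ n              ≡⟨ ℤ.+-cancelˡ-⊖ q m n ⟨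
  (q + m) ℤ.⊖ (q + n)  ≤⟨ ℤ.⊖-monoˡ-≤ (q + n) q+m≤n+o ⟩
  (n + o) ℤ.⊖ (q + n)  ≡⟨ cong ((n + o) ℤ.⊖_) (ℕ.+-comm q n) ⟩
  (n + o) ℤ.⊖ (n + q)  ≡⟨ ℤ.+-cancelˡ-⊖ n o q ⟩
  o ℤ.⊖ q              ≡⟨ ℤ.m-n≡m⊖n o q ⟨
  (+ o) - (+ q)        ∎
  where
  open ℤ.≤-Reasoning
  q+m≤n+o : q + m ≤ n + o
  q+m≤n+o = subst₂ _≤_ (ℕ.+-comm m q) (ℕ.+-comm o n) m+q≤o+n

∣p∪q∣≤∣p∣+∣q∣ : ∀ {k} (p q : Subset k) → ∣ p ∪ q ∣ ≤ ∣ p ∣ + ∣ q ∣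
∣p∪q∣≤∣p∣+∣q∣ []            []            = z≤n
∣p∪q∣≤∣p∣+∣q∣ (inside ∷ p)  (inside ∷ q)  =
  s≤s (ℕ.≤-trans (∣p∪q∣≤∣p∣+∣q∣ p q) (ℕ.+-monoʳ-≤ ∣ p ∣ (ℕ.n≤1+n ∣ q ∣)))
∣p∪q∣≤∣p∣+∣q∣ (inside ∷ p)  (outside ∷ q) = s≤s (∣p∪q∣≤∣p∣+∣q∣ p q)
∣p∪q∣≤∣p∣+∣q∣ (outside ∷ p) (inside ∷ q)  =
  ℕ.≤-trans (s≤s (∣p∪q∣≤∣p∣+∣q∣ p q)) (ℕ.≤-reflexive (sym (ℕ.+-suc ∣ p ∣ ∣ q ∣)))
∣p∪q∣≤∣p∣+∣q∣ (outside ∷ p) (outside ∷ q) = ∣p∪q∣≤∣p∣+∣q∣ p q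

∣p∪⁅x⁆∣≤1+∣p∣ : ∀ {k} (p : Subset k) (x : Fin k) → ∣ p ∪ ⁅ x ⁆ ∣ ≤ suc ∣ p ∣
∣p∪⁅x⁆∣≤1+∣p∣ p x = subst (∣ p ∪ ⁅ x ⁆ ∣ ≤_)
  (trans (cong (_+_ ∣ p ∣) (∣⁅x⁆∣≡1 x)) (ℕ.+-comm ∣ p ∣ 1))
  (∣p∪q∣≤∣p∣+∣q∣ p ⁅ x ⁆)

Empty-∁⇒n≤∣p∣ : ∀ {k} (p : Subset k) → Empty (∁ p) → k ≤ ∣ p ∣
Empty-∁⇒n≤∣p∣ {k} p ∁p-empty = ℕ.m∸n≡0⇒m≤n (begin
  k ∸ ∣ p ∣    ≡⟨ ∣∁p∣≡n∸∣p∣ p ⟨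
  ∣ ∁ p ∣      ≡⟨ cong ∣_∣ (Empty-unique ∁p-empty) ⟩
  ∣ ⊥ {k} ∣    ≡⟨ ∣⊥∣≡0 k ⟩
  0            ∎)
  where open ≡-Reasoning

module _ {k} {P : Fin k → Set} (P? : ∀ i → Dec (P i)) where

  select : Subset k
  select = tabulate (λ i → does (P? i))

  ∈-select⁻ : ∀ i → i ∈ select → P i
  ∈-select⁻ i i∈ with P? i | trans (sym (lookup∘tabulate (λ j → does (P? j)) i)) ([]=⇒lookup i∈)
  ... | yes Pi | _ = Pi
  ... | no _   | ()

  ∈-select⁺ : ∀ i → P i → i ∈ select
  ∈-select⁺ i Pi = lookup⇒[]= i select
    (trans (lookup∘tabulate (λ j → does (P? j)) i) (dec-true (P? i) Pi))

module _ {m} (M : Matroid m) where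

  ∈cl-mono : ∀ {X Y} e → X ⊆ Y → e ∈cl[ M ] X → e ∈cl[ M ] Y
  ∈cl-mono {X} {Y} e X⊆Y e∈clX =
    ℕ.≤-antisym rY∪e≤rY (r-mono M (p⊆p∪q ⁅ e ⁆))
    where
    X∪e : Subset m
    X∪e = X ∪ ⁅ e ⁆
    Y∪e⊆X∪e∪Y : Y ∪ ⁅ e ⁆ ⊆ X∪e ∪ Y
    Y∪e⊆X∪e∪Y x∈ = [ q⊆p∪q X∪e Y , (λ x∈e → p⊆p∪q Y (q⊆p∪q X ⁅ e ⁆ x∈e)) ]′
                     (x∈p∪q⁻ Y ⁅ e ⁆ x∈)
    X⊆X∪e∩Y : X ⊆ X∪e ∩ Y
    X⊆X∪e∩Y x∈ = x∈p∩q⁺ (p⊆p∪q ⁅ e ⁆ x∈ , X⊆Y x∈)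
    rX+rY∪e≤rX+rY : r M X + r M (Y ∪ ⁅ e ⁆) ≤ r M X + r M Y
    rX+rY∪e≤rX+rY = begin
      r M X + r M (Y ∪ ⁅ e ⁆)        ≡⟨ ℕ.+-comm (r M X) (r M (Y ∪ ⁅ e ⁆)) ⟩
      r M (Y ∪ ⁅ e ⁆) + r M X        ≤⟨ ℕ.+-mono-≤ (r-mono M Y∪e⊆X∪e∪Y) (r-mono M X⊆X∪e∩Y) ⟩
      r M (X∪e ∪ Y) + r M (X∪e ∩ Y)  ≤⟨ r-submod M X∪e Y ⟩
      r M X∪e + r M Y                ≡⟨ cong (_+ r M Y) e∈clX ⟩
      r M X + r M Y                  ∎
      where open ℕ.≤-Reasoning
    rY∪e≤rY : r M (Y ∪ ⁅ e ⁆) ≤ r M Y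
    rY∪e≤rY = ℕ.+-cancelˡ-≤ (r M X) _ _ rX+rY∪e≤rX+rY

  ∉cl⇒r<r∪⁅e⁆ : ∀ {X} e → ¬ (e ∈cl[ M ] X) → r M X < r M (X ∪ ⁅ e ⁆)
  ∉cl⇒r<r∪⁅e⁆ e e∉clX =
    ℕ.≤∧≢⇒< (r-mono M (p⊆p∪q ⁅ e ⁆)) (λ rX≡rX∪e → e∉clX (sym rX≡rX∪e))

module _ {n m} (G : Graph n m) where

  Exits : Subset n → Fin m → Fin n → Set
  Exits S e v = v ∉ S × ((end₁ G e ∈ S × end₂ G e ≡ v) ⊎ (end₂ G e ∈ S × end₁ G e ≡ v))

  reach⇒exit : ∀ {S u w} → Reach G u w → u ∈ S → w ∉ S → ∃₂ (Exits S)
  reach⇒exit here u∈S u∉S = contradiction u∈S u∉S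
  reach⇒exit {S} (step {w = x} e u-e-x x⇝w) u∈S w∉S with x ∈? S
  ... | yes x∈S = reach⇒exit x⇝w x∈S w∉S
  ... | no x∉S with u-e-x
  ...   | inj₁ (e₁≡u , e₂≡x) = e , x , x∉S , inj₁ (subst (_∈ S) (sym e₁≡u) u∈S , e₂≡x)
  ...   | inj₂ (e₂≡u , e₁≡x) = e , x , x∉S , inj₂ (subst (_∈ S) (sym e₂≡u) u∈S , e₁≡x)

  exits⇒Incident : ∀ {S e v} → Exits S e v → Incident G e v
  exits⇒Incident (_ , inj₁ (_ , e₂≡v)) = inj₂ e₂≡v
  exits⇒Incident (_ , inj₂ (_ , e₁≡v)) = inj₁ e₁≡v

  exits⇒¬IsLoopAt : ∀ {S e v} → Exits S e v → ¬ IsLoopAt G e v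
  exits⇒¬IsLoopAt {S} (v∉S , inj₁ (e₁∈S , _)) (e₁≡v , _) = v∉S (subst (_∈ S) e₁≡v e₁∈S)
  exits⇒¬IsLoopAt {S} (v∉S , inj₂ (e₂∈S , _)) (_ , e₂≡v) = v∉S (subst (_∈ S) e₂≡v e₂∈S)

  exit-extends-IsSubgraph : ∀ {S F e v} → IsSubgraph G S F → Exits S e v →
                            IsSubgraph G (S ∪ ⁅ v ⁆) (F ∪ ⁅ e ⁆)
  exit-extends-IsSubgraph {S} {F} {e} {v} F⊆S e-exits f f∈F∪e with x∈p∪q⁻ F ⁅ e ⁆ f∈F∪e
  ... | inj₁ f∈F = p⊆p∪q ⁅ v ⁆ (proj₁ (F⊆S f f∈F)) , p⊆p∪q ⁅ v ⁆ (proj₂ (F⊆S f f∈F))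
  ... | inj₂ f∈e rewrite x∈⁅y⁆⇒x≡y e f∈e = ends-e e-exits
    where
    v∈S∪v : v ∈ S ∪ ⁅ v ⁆
    v∈S∪v = q⊆p∪q S ⁅ v ⁆ (x∈⁅x⁆ v)
    ends-e : Exits S e v → end₁ G e ∈ S ∪ ⁅ v ⁆ × end₂ G e ∈ S ∪ ⁅ v ⁆
    ends-e (_ , inj₁ (e₁∈S , e₂≡v)) = p⊆p∪q ⁅ v ⁆ e₁∈S , subst (_∈ S ∪ ⁅ v ⁆) (sym e₂≡v) v∈S∪v
    ends-e (_ , inj₂ (e₂∈S , e₁≡v)) = subst (_∈ S ∪ ⁅ v ⁆) (sym e₁≡v) v∈S∪v , p⊆p∪q ⁅ v ⁆ e₂∈S

  IsSubgraph⇒⊆EdgesMinus : ∀ {S F v F′} → IsSubgraph G S F → v ∉ S → EdgesMinus G v F′ → F ⊆ F′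
  IsSubgraph⇒⊆EdgesMinus {S} {v = v} F⊆S v∉S F′-avoids {f} f∈F =
    proj₂ (F′-avoids f) ( (λ f₁≡v → v∉S (subst (_∈ S) f₁≡v (proj₁ (F⊆S f f∈F))))
                        , (λ f₂≡v → v∉S (subst (_∈ S) f₂≡v (proj₂ (F⊆S f f∈F)))))

  avoids? : ∀ v e → Dec ((end₁ G e ≢ v) × (end₂ G e ≢ v))
  avoids? v e = ¬? (end₁ G e ≟ v) ×-dec ¬? (end₂ G e ≟ v)

  edgesMinus : Fin n → Subset m
  edgesMinus v = select (avoids? v)

  edgesMinus-EdgesMinus : ∀ v → EdgesMinus G v (edgesMinus v)
  edgesMinus-EdgesMinus v e = ∈-select⁻ (avoids? v) e , ∈-select⁺ (avoids? v) e

module _ {n m} {G : Graph n m} {M : Matroid m} (wf : WeakFramework G M) where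

  exit-∉cl-EdgesMinus : ∀ {S e v F} → Exits G S e v → EdgesMinus G v F → ¬ (e ∈cl[ M ] F)
  exit-∉cl-EdgesMinus {e = e} {v} {F} e-exits F-avoids e∈clF
    with WeakFramework.closure wf v F F-avoids e e∈clF
  ... | inj₁ e∈F  = [ proj₁ e-avoids , proj₂ e-avoids ]′ (exits⇒Incident G e-exits)
    where
    e-avoids : (end₁ G e ≢ v) × (end₂ G e ≢ v)
    e-avoids = proj₁ (F-avoids e) e∈F
  ... | inj₂ loop = exits⇒¬IsLoopAt G e-exits loop

  exit-raises-rank : ∀ {S F e v} → IsSubgraph G S F → Exits G S e v → r M F < r M (F ∪ ⁅ e ⁆)
  exit-raises-rank {F = F} {e} {v} F⊆S e-exits@(v∉S , _) =
    ∉cl⇒r<r∪⁅e⁆ M e (λ e∈clF → exit-∉cl-EdgesMinus e-exits G-v (∈cl-mono M e F⊆G-v e∈clF))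
    where
    G-v : EdgesMinus G v (edgesMinus G v)
    G-v = edgesMinus-EdgesMinus G v
    F⊆G-v : F ⊆ edgesMinus G v
    F⊆G-v = IsSubgraph⇒⊆EdgesMinus G F⊆S v∉S G-v

  module _ (conn : Connected G) where

    deficiency-bound : ∀ {S F} → Acc _⊃_ S → IsSubgraph G S F → Nonempty S →
                       n + r M F ≤ ∣ S ∣ + r M ⊤
    deficiency-bound {S} {F} (acc rec) F⊆S (u , u∈S) with nonempty? (∁ S)
    ... | no ∁S-empty = ℕ.+-mono-≤ (Empty-∁⇒n≤∣p∣ S ∁S-empty) (r-mono M ⊆⊤)
    ... | yes (w , w∈∁S) with reach⇒exit G (conn u w) u∈S (x∈∁p⇒x∉p w∈∁S)
    ...   | e , v , e-exits@(v∉S , _) = s≤s⁻¹ (begin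
      suc (n + r M F)                 ≡⟨ ℕ.+-suc n (r M F) ⟨
      n + suc (r M F)                 ≤⟨ ℕ.+-monoʳ-≤ n (exit-raises-rank F⊆S e-exits) ⟩
      n + r M (F ∪ ⁅ e ⁆)             ≤⟨ deficiency-bound (rec S⊂S∪v) F⊆S∪v (u , p⊆p∪q ⁅ v ⁆ u∈S) ⟩
      ∣ S ∪ ⁅ v ⁆ ∣ + r M ⊤           ≤⟨ ℕ.+-monoˡ-≤ (r M ⊤) (∣p∪⁅x⁆∣≤1+∣p∣ S v) ⟩
      suc (∣ S ∣ + r M ⊤)             ∎)
      where
      open ℕ.≤-Reasoning
      S⊂S∪v : S ⊂ S ∪ ⁅ v ⁆
      S⊂S∪v = p⊆p∪q ⁅ v ⁆ , v , q⊆p∪q S ⁅ v ⁆ (x∈⁅x⁆ v) , v∉S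
      F⊆S∪v : IsSubgraph G (S ∪ ⁅ v ⁆) (F ∪ ⁅ e ⁆)
      F⊆S∪v = exit-extends-IsSubgraph G F⊆S e-exits

lemma2p3 : ∀ {n m} (G : Graph n m) (M : Matroid m) →
    Connected G → WeakFramework G M →
    (VH : Subset n) (EH : Subset m) → IsSubgraph G VH EH → Nonempty VH →
    (+ ∣ VH ∣) - (+ r M EH) ≥ (+ n) - (+ r M ⊤)
lemma2p3 {n} G M conn wf VH EH EH⊆VH VH-nonempty =
  m+q≤o+n⇒m-n≤o-q n (r M ⊤) ∣ VH ∣ (r M EH)
    (deficiency-bound wf conn (⊃-wellFounded VH) EH⊆VH VH-nonempty)
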